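{- For every formula $A\in\mathsf{Form}_\bot$: if $\vdash_{\bot_w}A$, then $\vdash_j A$.
   Context: $\mathsf{Form}_\bot$: formulas built from a countable set $\mathsf{Prop}$ of propositional variables and the constant $\bot$ using binary connectives $\land,\lor,\to$. $\mathsf{Form}_{\bot,\supset}$ additionally allows the binary connective $\supset$. $\vdash_j$ is derivability (from no assumptions) in Johansson's minimal propositional logic $\mathbf{MPC}$: axiom schemata (Ax1) $A\to(B\to A)$; (Ax2) $(A\to(B\to C))\to((A\to B)\to(A\to C))$; (Ax3) $(A\land B)\to A$; (Ax4) $(A\land B)\to B$; (Ax5) $(C\to A)\to((C\to B)\to(C\to(A\land B)))$; (Ax6) $A\to(A\lor B)$; (Ax7) $B\to(A\lor B)$; (Ax8) $(A\to C)\to((B\to C)\to((A\lor B)\to C))$, with the rule from $A$ and $A\to B$ infer $B$, and no axiom governing $\bot$. $\vdash_{\bot_w}$ is derivability (from no assumptions) in the system $\mathbf{S}_{\bot_w}$ over $\mathsf{Form}_{\bot,\supset}$: axiom schemata (Ax1)–(Ax8) above together with (AxM1) $(A\to B)\supset(A\supset B)$; (AxM2) $(A\supset(B\supset C))\to((A\supset B)\supset(A\supset C))$; (AxM3) $(A\supset(B\to C))\to(B\to(A\supset C))$; (AxM4) $(A\to(B\supset C))\to(B\supset(A\to C))$; (AxM5) $((A\supset B)\supset C)\to((A\supset C)\to C)$; (AxM6) $(A\supset C)\to((B\supset C)\to((A\lor B)\supset C))$; (AxE) $\bot\supset A$; and the single rule: from $A$ and $A\supset B$ infer $B$. -}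

module Defs where

open import Data.Nat using (ℕ)

Prop : Set
Prop = ℕ

data Form : Set where
  var  : Prop → Form
  ⊥'   : Form
  _∧'_ : Form → Form → Form
  _∨'_ : Form → Form → Form
  _⇒_  : Form → Form → Form

infixr 5 _⇒_
infixr 7 _∧'_
infixr 6 _∨'_

data FormS : Set where
  var  : Prop → FormS
  ⊥'   : FormS
  _∧'_ : FormS → FormS → FormS
  _∨'_ : FormS → FormS → FormS
  _⇒_  : FormS → FormS → FormS
  _⊃_  : FormS → FormS → FormS

infixr 5 _⊃_

embed : Form → FormS
embed (var p) = var p
embed ⊥' = ⊥'
embed (A ∧' B) = embed A ∧' embed B
embed (A ∨' B) = embed A ∨' embed B
embed (A ⇒ B) = embed A ⇒ embed B

-- Johansson's minimal propositional logic MPC (Hilbert style, no assumptions)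
data ⊢j_ : Form → Set where
  ax1 : ∀ {A B} → ⊢j (A ⇒ (B ⇒ A))
  ax2 : ∀ {A B C} → ⊢j ((A ⇒ (B ⇒ C)) ⇒ ((A ⇒ B) ⇒ (A ⇒ C)))
  ax3 : ∀ {A B} → ⊢j ((A ∧' B) ⇒ A)
  ax4 : ∀ {A B} → ⊢j ((A ∧' B) ⇒ B)
  ax5 : ∀ {A B C} → ⊢j ((C ⇒ A) ⇒ ((C ⇒ B) ⇒ (C ⇒ (A ∧' B))))
  ax6 : ∀ {A B} → ⊢j (A ⇒ (A ∨' B))
  ax7 : ∀ {A B} → ⊢j (B ⇒ (A ∨' B))
  ax8 : ∀ {A B C} → ⊢j ((A ⇒ C) ⇒ ((B ⇒ C) ⇒ ((A ∨' B) ⇒ C)))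
  mp  : ∀ {A B} → ⊢j A → ⊢j (A ⇒ B) → ⊢j B

data ⊢w_ : FormS → Set where
  ax1 : ∀ {A B} → ⊢w (A ⇒ (B ⇒ A))
  ax2 : ∀ {A B C} → ⊢w ((A ⇒ (B ⇒ C)) ⇒ ((A ⇒ B) ⇒ (A ⇒ C)))
  ax3 : ∀ {A B} → ⊢w ((A ∧' B) ⇒ A)
  ax4 : ∀ {A B} → ⊢w ((A ∧' B) ⇒ B)
  ax5 : ∀ {A B C} → ⊢w ((C ⇒ A) ⇒ ((C ⇒ B) ⇒ (C ⇒ (A ∧' B))))
  ax6 : ∀ {A B} → ⊢w (A ⇒ (A ∨' B))
  ax7 : ∀ {A B} → ⊢w (B ⇒ (A ∨' B))
  ax8 : ∀ {A B C} → ⊢w ((A ⇒ C) ⇒ ((B ⇒ C) ⇒ ((A ∨' B) ⇒ C)))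
  axM1 : ∀ {A B} → ⊢w ((A ⇒ B) ⊃ (A ⊃ B))
  axM2 : ∀ {A B C} → ⊢w ((A ⊃ (B ⊃ C)) ⇒ ((A ⊃ B) ⊃ (A ⊃ C)))
  axM3 : ∀ {A B C} → ⊢w ((A ⊃ (B ⇒ C)) ⇒ (B ⇒ (A ⊃ C)))
  axM4 : ∀ {A B C} → ⊢w ((A ⇒ (B ⊃ C)) ⇒ (B ⊃ (A ⇒ C)))
  axM5 : ∀ {A B C} → ⊢w (((A ⊃ B) ⊃ C) ⇒ ((A ⊃ C) ⇒ C))
  axM6 : ∀ {A B C} → ⊢w ((A ⊃ C) ⇒ ((B ⊃ C) ⇒ ((A ∨' B) ⊃ C)))
  axE  : ∀ {A} → ⊢w (⊥' ⊃ A)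
  mp⊃  : ∀ {A B} → ⊢w A → ⊢w (A ⊃ B) → ⊢w B

module Submission where

open import Data.Empty using (⊥; ⊥-elim)
open import Data.Product using (_×_; _,_; proj₁; proj₂)
open import Data.Sum using (_⊎_; inj₁; inj₂; [_,_])
import Data.Sum as Sum
open import Function using (_∘_; id)

open import Defs

-- Normalisation by evaluation. Fix an answer type R and force formulas through the
-- continuation monad (− → R) → R in a Kripke model whose worlds are the MPC contexts X,
-- ordered by provable implication, together with a least world ∗ at which nothing is
-- provable, so that every formula is forced at ∗ as soon as an answer is available.
-- Disjunction is forced through covers, i.e. finite trees of ∨-splittings of the context,
-- and a ⊃ b is forced at w when forcing a at ∗ yields b at w. All S_⊥w axioms are valid at
-- ∗ (axE because ∗ forces ⊥, axM5 because the monad gives a control operator), and for a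
-- ⊃-free A forcing at X reifies to an MPC proof of A from X. Choosing R to be provability
-- of A and X a provable context turns a proof in S_⊥w into one in MPC.

infix 4 _⊢_

_⊢_ : Form → Form → Set
X ⊢ A = ⊢j (X ⇒ A)

private variable
  X A B C : Form

⊢-refl : ∀ {A} → A ⊢ A
⊢-refl {A} = mp (ax1 {A} {A}) (mp (ax1 {A} {A ⇒ A}) ax2)

⊢-const : ⊢j A → X ⊢ A
⊢-const p = mp p ax1

⊢-app : X ⊢ (A ⇒ B) → X ⊢ A → X ⊢ B
⊢-app f a = mp a (mp f ax2)

⊢-trans : A ⊢ B → B ⊢ C → A ⊢ C
⊢-trans f g = ⊢-app (⊢-const g) f

∧-intro : X ⊢ A → X ⊢ B → X ⊢ (A ∧' B)
∧-intro a b = mp b (mp a ax5)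

∧-elimˡ : X ⊢ (A ∧' B) → X ⊢ A
∧-elimˡ p = ⊢-trans p ax3

∧-elimʳ : X ⊢ (A ∧' B) → X ⊢ B
∧-elimʳ p = ⊢-trans p ax4

∧-monoˡ : X ⊢ A → (X ∧' B) ⊢ (A ∧' B)
∧-monoˡ p = ∧-intro (⊢-trans ax3 p) ax4

⇒-intro : (X ∧' A) ⊢ B → X ⊢ (A ⇒ B)
⇒-intro p = ⊢-trans pairing (mp (⊢-const p) ax2)
  where
  pairing : X ⊢ (A ⇒ (X ∧' A))
  pairing = ⊢-app (⊢-app (⊢-const ax5) ax1) (⊢-const ⊢-refl)

∨-introˡ : X ⊢ A → X ⊢ (A ∨' B)
∨-introˡ p = ⊢-trans p ax6

∨-introʳ : X ⊢ B → X ⊢ (A ∨' B)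
∨-introʳ p = ⊢-trans p ax7

∨-elim : (X ∧' A) ⊢ C → (X ∧' B) ⊢ C → X ⊢ (A ∨' B) → X ⊢ C
∨-elim f g = ⊢-app (⊢-app (⊢-app (⊢-const ax8) (⇒-intro f)) (⇒-intro g))

⊤' : Form
⊤' = ⊥' ⇒ ⊥'

module Forcing (R : Set) where

  Cont : Set → Set
  Cont P = (P → R) → R

  return : {P : Set} → P → Cont P
  return p κ = κ p

  infixl 1 _>>=_

  _>>=_ : {P Q : Set} → Cont P → (P → Cont Q) → Cont Q
  (k >>= f) κ = k (λ p → f p κ)

  data World : Set where
    ∗   : World
    ctx : Form → World

  infix 4 _≼_

  data _≼_ : World → World → Set where
    ∗≼   : ∀ {w} → ∗ ≼ w
    ctx≼ : ∀ {X Y} → Y ⊢ X → ctx X ≼ ctx Y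

  ≼-refl : ∀ {w} → w ≼ w
  ≼-refl {∗}     = ∗≼
  ≼-refl {ctx X} = ctx≼ ⊢-refl

  ≼-trans : ∀ {u v w} → u ≼ v → v ≼ w → u ≼ w
  ≼-trans ∗≼       _        = ∗≼
  ≼-trans (ctx≼ p) (ctx≼ q) = ctx≼ (⊢-trans q p)

  Proof : World → Form → Set
  Proof ∗       A = ⊥
  Proof (ctx X) A = X ⊢ A

  Proof-mono : ∀ {v w A} → v ≼ w → Proof v A → Proof w A
  Proof-mono ∗≼       = ⊥-elim
  Proof-mono (ctx≼ p) = ⊢-trans p

  data Cover (G : World → Set) : World → Set where
    leaf : ∀ {w} → G w → Cover G w
    node : ∀ {X} Y Z → X ⊢ (Y ∨' Z) →
           Cover G (ctx (X ∧' Y)) → Cover G (ctx (X ∧' Z)) → Cover G (ctx X)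

  Cover-mono : ∀ {G} → (∀ {v w} → v ≼ w → G v → G w) →
               ∀ {v w} → v ≼ w → Cover G v → Cover G w
  Cover-mono G-mono le (leaf g) = leaf (G-mono le g)
  Cover-mono G-mono (ctx≼ p) (node Y Z h c₁ c₂) =
    node Y Z (⊢-trans p h) (Cover-mono G-mono (ctx≼ (∧-monoˡ p)) c₁)
                           (Cover-mono G-mono (ctx≼ (∧-monoˡ p)) c₂)

  infix 4 _⊩_

  _⊩_ : World → FormS → Set
  w ⊩ var p    = Cont (Proof w (var p))
  w ⊩ ⊥'       = Cont (Proof w ⊥')
  w ⊩ (a ∧' b) = w ⊩ a × w ⊩ b
  w ⊩ (a ∨' b) = Cont (Cover (λ v → v ⊩ a ⊎ v ⊩ b) w)
  w ⊩ (a ⇒ b)  = ∀ {v} → w ≼ v → v ⊩ a → v ⊩ b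
  w ⊩ (a ⊃ b)  = ∗ ⊩ a → w ⊩ b

  ⊩-mono : ∀ a {v w} → v ≼ w → v ⊩ a → w ⊩ a
  ⊩-mono (var p)  le x       = x >>= return ∘ Proof-mono le
  ⊩-mono ⊥'       le x       = x >>= return ∘ Proof-mono le
  ⊩-mono (a ∧' b) le (x , y) = ⊩-mono a le x , ⊩-mono b le y
  ⊩-mono (a ∨' b) le x       =
    x >>= return ∘ Cover-mono (λ le′ → Sum.map (⊩-mono a le′) (⊩-mono b le′)) le
  ⊩-mono (a ⇒ b)  le f       = f ∘ ≼-trans le
  ⊩-mono (a ⊃ b)  le f       = ⊩-mono b le ∘ f

  ⊩-stable : ∀ a {w} → Cont (w ⊩ a) → w ⊩ a
  ⊩-stable (var p)  k = k >>= id
  ⊩-stable ⊥'       k = k >>= id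
  ⊩-stable (a ∧' b) k = ⊩-stable a (k >>= return ∘ proj₁) , ⊩-stable b (k >>= return ∘ proj₂)
  ⊩-stable (a ∨' b) k = k >>= id
  ⊩-stable (a ⇒ b)  k le x = ⊩-stable b (k >>= λ f → return (f le x))
  ⊩-stable (a ⊃ b)  k x    = ⊩-stable b (k >>= λ f → return (f x))

  ⊩-explode : ∀ a {w} → R → w ⊩ a
  ⊩-explode a r = ⊩-stable a (λ _ → r)

  ⊩-glue : ∀ c {X P Q} → ctx (X ∧' P) ⊩ c → ctx (X ∧' Q) ⊩ c → X ⊢ (P ∨' Q) → ctx X ⊩ c
  ⊩-glue (var p) x y h = do
    u ← x
    v ← y
    return (∨-elim u v h)
  ⊩-glue ⊥' x y h = do
    u ← x
    v ← y
    return (∨-elim u v h)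
  ⊩-glue (a ∧' b) (x₁ , y₁) (x₂ , y₂) h = ⊩-glue a x₁ x₂ h , ⊩-glue b y₁ y₂ h
  ⊩-glue (a ∨' b) {P = P} {Q} x y h = do
    c₁ ← x
    c₂ ← y
    return (node P Q h c₁ c₂)
  ⊩-glue (a ⇒ b) f g h (ctx≼ p) x =
    ⊩-glue b (f (ctx≼ (∧-monoˡ p)) (⊩-mono a (ctx≼ ax3) x))
             (g (ctx≼ (∧-monoˡ p)) (⊩-mono a (ctx≼ ax3) x))
             (⊢-trans p h)
  ⊩-glue (a ⊃ b) f g h x = ⊩-glue b (f x) (g x) h

  ⊩-cover : ∀ c {G w} → Cover G w → (∀ {v} → w ≼ v → G v → v ⊩ c) → w ⊩ c
  ⊩-cover c (leaf g)            H = H ≼-refl g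
  ⊩-cover c (node Y Z h c₁ c₂) H =
    ⊩-glue c (⊩-cover c c₁ (H ∘ ≼-trans (ctx≼ ax3)))
             (⊩-cover c c₂ (H ∘ ≼-trans (ctx≼ ax3)))
             h

  ⊩-∨-elim : ∀ a b c {w} → (∀ {v} → w ≼ v → v ⊩ a → v ⊩ c) →
             (∀ {v} → w ≼ v → v ⊩ b → v ⊩ c) → w ⊩ (a ∨' b) → w ⊩ c
  ⊩-∨-elim a b c f g x =
    ⊩-stable c (x >>= λ cv → return (⊩-cover c cv (λ le → [ f le , g le ])))

  sound : ∀ {a} → ⊢w a → ∗ ⊩ a
  sound (ax1 {a}) _ x le _        = ⊩-mono a le x
  sound ax2       _ f le g le′ x  = f (≼-trans le le′) x ≼-refl (g le′ x)
  sound ax3       _               = proj₁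
  sound ax4       _               = proj₂
  sound ax5       _ f le g le′ x  = f (≼-trans le le′) x , g le′ x
  sound ax6       _ x             = return (leaf (inj₁ x))
  sound ax7       _ x             = return (leaf (inj₂ x))
  sound (ax8 {a} {b} {c}) _ f le g le′ =
    ⊩-∨-elim a b c (f ∘ ≼-trans (≼-trans le le′)) (g ∘ ≼-trans le′)
  sound axM1      f               = f ≼-refl
  sound axM2      _ f g x         = f x (g x)
  sound axM3      _ f le y x      = f x le y
  sound axM4      _ f x le y      = f le y x
  -- Peirce's law by control: either f yields c, or the escape continuation κ is used to
  -- supply an element of a ⊃ b, by explosion at ∗.
  sound (axM5 {a} {b} {c}) _ f le g =
    ⊩-stable c λ κ → κ (⊩-mono c le (f (λ x → ⊩-explode b (κ (g x)))))
  sound (axM6 {C = c}) _ f le g x = ⊩-stable c λ κ → x λ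
    { (leaf (inj₁ y)) → κ (⊩-mono c le (f y))
    ; (leaf (inj₂ y)) → κ (g y)
    }
  sound (axE {a}) x               = ⊩-explode a (x ⊥-elim)
  sound (mp⊃ d e)                 = sound e (sound d)

  reflect : ∀ A {X} → X ⊢ A → ctx X ⊩ embed A
  reify   : ∀ A {X} → ctx X ⊩ embed A → Cont (X ⊢ A)

  reflect (var p)  h = return h
  reflect ⊥'       h = return h
  reflect (A ∧' B) h = reflect A (∧-elimˡ h) , reflect B (∧-elimʳ h)
  reflect (A ∨' B) h =
    return (node A B h (leaf (inj₁ (reflect A ax4))) (leaf (inj₂ (reflect B ax4))))
  reflect (A ⇒ B)  h (ctx≼ p) x = ⊩-stable (embed B) do
    a ← reify A x
    return (reflect B (⊢-app (⊢-trans p h) a))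

  reify (var p)  x = x
  reify ⊥'       x = x
  reify (A ∧' B) (x , y) = do
    a ← reify A x
    b ← reify B y
    return (∧-intro a b)
  reify (A ∨' B) x = x >>= reifyCover
    where
    reifyCover : ∀ {Y} → Cover (λ v → v ⊩ embed A ⊎ v ⊩ embed B) (ctx Y) → Cont (Y ⊢ (A ∨' B))
    reifyCover (leaf (inj₁ y)) = reify A y >>= return ∘ ∨-introˡ
    reifyCover (leaf (inj₂ y)) = reify B y >>= return ∘ ∨-introʳ
    reifyCover (node Y Z h c₁ c₂) = do
      p ← reifyCover c₁
      q ← reifyCover c₂
      return (∨-elim p q h)
  reify (A ⇒ B) f = reify B (f (ctx≼ ax3) (reflect A ax4)) >>= return ∘ ⇒-intro

mainTheorem20 : (A : Form) → ⊢w (embed A) → ⊢j A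
mainTheorem20 A d = reify A (⊩-mono (embed A) (∗≼ {ctx ⊤'}) (sound d)) (mp ⊢-refl)
  where open Forcing (⊢j A)
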